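{- Let $E=\{a_1/b_1,\ldots,a_k/b_k\}$ be a finite set of rational numbers, each written in lowest terms ($a_i\in\mathbb{Z}$, $b_i$ a positive integer, $\gcd(a_i,b_i)=1$) with $b_i\ge 2$ for all $i$. Then $$t_M(E)=\max_{i=1,\ldots,k}\frac{1}{b_i}.$$
   Context: For compact $E\subset\mathbb{C}$, $\|f\|_E:=\sup_{z\in E}|f(z)|$; $\mathcal{M}_n(\mathbb{Z})$ is the set of monic integer-coefficient polynomials of exact degree $n$; and the monic integer Chebyshev constant is $t_M(E):=\lim_{n\to\infty}\big(\inf_{P\in\mathcal{M}_n(\mathbb{Z})}\|P\|_E\big)^{1/n}$ (this limit exists). -}

module Defs where

open import Data.Nat as ℕ using (ℕ; zero; suc; _≤_; s≤s; z≤n)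
open import Data.Integer as ℤ using (ℤ; +_)
open import Data.Rational as ℚ using (ℚ; 0ℚ; 1ℚ; _/_; _+_; _*_; _-_; _⊔_; ∣_∣)
open import Data.Vec using (Vec; []; _∷_)
open import Data.List using (List; foldr)
open import Data.Fin using (Fin)

_^ℚ_ : ℚ → ℕ → ℚ
x ^ℚ zero  = 1ℚ
x ^ℚ suc n = x * (x ^ℚ n)

-- A monic integer polynomial of exact degree n:
--   P(z) = z^n + c₀ z^(n-1) + c₁ z^(n-2) + … + c_{n-1}
-- represented by its n non-leading integer coefficients (leading coefficient 1).
Monic : ℕ → Set
Monic n = Vec ℤ n

evalAcc : ∀ {n} → ℚ → Vec ℤ n → ℚ → ℚ
evalAcc acc []       x = acc
evalAcc acc (c ∷ cs) x = evalAcc (acc * x + (c / 1)) cs x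

evalMonic : ∀ {n} → Monic n → ℚ → ℚ
evalMonic cs x = evalAcc 1ℚ cs x

-- sup norm of f over a finite set E (given as a list of its points);
-- for nonempty E this is max_{z ∈ E} |f z|.
supNorm : List ℚ → (ℚ → ℚ) → ℚ
supNorm E f = foldr (λ z m → ∣ f z ∣ ⊔ m) 0ℚ E

frac : ℤ → (b : ℕ) → 2 ≤ b → ℚ
frac a (suc b) _ = a / suc b

maxList : List ℚ → ℚ
maxList = foldr _⊔_ 0ℚ

{-# OPTIONS --safe #-}
-- A monic integer polynomial P of degree n takes at a point x = a/b in lowest terms
-- the value N/bⁿ, where N = aⁿ + b·(…) is an integer. For b ≥ 2, b ∤ aⁿ, so N ≠ 0 and
-- |P(x)| ≥ b⁻ⁿ; this is the lower bound.
-- For the upper bound the numerators N are adjusted one point r at a time. Adding to P a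
-- multiple of (the product of the linear forms vanishing at the earlier points) times (a
-- power of a linear form equal to 1 at r, by Bézout) leaves the earlier numerators unchanged
-- and shifts N_r by any multiple of d_r = b_r·∏(b_j a_r − a_j b_r). So every |N_r| can be made
-- smaller than |d_r|, a bound K independent of n. Then |P| ≤ K·Lⁿ on E, where L = max 1/b,
-- and K·Lⁿ ≤ Lⁿ(1 + nε) ≤ (L + ε)ⁿ for large n by Bernoulli's inequality.
module Submission where

module BinaryForm where

  open import Data.Nat.Base using (ℕ; zero; suc)
  open import Data.Integer.Base using (ℤ; 0ℤ; 1ℤ; _+_; _*_; _^_)
  open import Data.Integer.Properties using (*-assoc)
  open import Data.Integer.Tactic.RingSolver using (solve-∀)
  open import Data.Vec.Base using (Vec; []; _∷_; zipWith)
  open import Relation.Binary.PropositionalEquality using (_≡_; refl; cong; module ≡-Reasoning)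
  open ≡-Reasoning

  private variable
    m d : ℕ

  -- evalForm a b (c₀ ∷ … ∷ cₘ₋₁) = Σⱼ cⱼ a^(m-1-j) bʲ, the value at (a, b) of a binary form of
  -- degree m - 1.
  evalForm : ℤ → ℤ → Vec ℤ m → ℤ
  evalForm a b []               = 0ℤ
  evalForm {suc m} a b (c ∷ cs) = c * a ^ m + b * evalForm a b cs

  evalForm-zipWith-+ : ∀ a b (F G : Vec ℤ m) →
                       evalForm a b (zipWith _+_ F G) ≡ evalForm a b F + evalForm a b G
  evalForm-zipWith-+ a b []      []      = refl
  evalForm-zipWith-+ {suc m} a b (f ∷ F) (g ∷ G) = begin
    (f + g) * a ^ m + b * evalForm a b (zipWith _+_ F G)
      ≡⟨ cong (λ t → (f + g) * a ^ m + b * t) (evalForm-zipWith-+ a b F G) ⟩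
    (f + g) * a ^ m + b * (evalForm a b F + evalForm a b G)
      ≡⟨ distrib f g (a ^ m) b (evalForm a b F) (evalForm a b G) ⟩
    (f * a ^ m + b * evalForm a b F) + (g * a ^ m + b * evalForm a b G) ∎
    where
    distrib : ∀ f g p b x y → (f + g) * p + b * (x + y) ≡ (f * p + b * x) + (g * p + b * y)
    distrib = solve-∀

  addLeading : ℤ → Vec ℤ (suc m) → Vec ℤ (suc m)
  addLeading z (c ∷ cs) = z + c ∷ cs

  evalForm-addLeading : ∀ a b z (F : Vec ℤ (suc m)) →
                        evalForm a b (addLeading z F) ≡ z * a ^ m + evalForm a b F
  evalForm-addLeading a b z (c ∷ cs) = distrib z c _ _
    where
    distrib : ∀ z c p q → (z + c) * p + q ≡ z * p + (c * p + q)
    distrib = solve-∀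

  mulLinear : ℤ → ℤ → Vec ℤ (suc d) → Vec ℤ (suc (suc d))
  mulLinear p q (c ∷ [])      = p * c ∷ q * c ∷ []
  mulLinear p q (c ∷ c′ ∷ cs) = p * c ∷ addLeading (q * c) (mulLinear p q (c′ ∷ cs))

  evalForm-mulLinear : ∀ a b p q (F : Vec ℤ (suc d)) →
                       evalForm a b (mulLinear p q F) ≡ (p * a + q * b) * evalForm a b F
  evalForm-mulLinear a b p q (c ∷ []) = linear p q a b c
    where
    linear : ∀ p q a b c → p * c * (a * 1ℤ) + b * (q * c * 1ℤ + b * 0ℤ)
                           ≡ (p * a + q * b) * (c * 1ℤ + b * 0ℤ)
    linear = solve-∀
  evalForm-mulLinear {suc d} a b p q (c ∷ c′ ∷ cs) = begin
    p * c * (a * a ^ suc d) + b * evalForm a b (addLeading (q * c) (mulLinear p q (c′ ∷ cs)))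
      ≡⟨ cong (λ t → p * c * (a * a ^ suc d) + b * t)
              (evalForm-addLeading a b (q * c) (mulLinear p q (c′ ∷ cs))) ⟩
    p * c * (a * a ^ suc d) + b * (q * c * a ^ suc d + evalForm a b (mulLinear p q (c′ ∷ cs)))
      ≡⟨ cong (λ t → p * c * (a * a ^ suc d) + b * (q * c * a ^ suc d + t))
              (evalForm-mulLinear a b p q (c′ ∷ cs)) ⟩
    p * c * (a * a ^ suc d) + b * (q * c * a ^ suc d + (p * a + q * b) * evalForm a b (c′ ∷ cs))
      ≡⟨ factor p q a b c (a ^ suc d) (evalForm a b (c′ ∷ cs)) ⟩
    (p * a + q * b) * (c * a ^ suc d + b * evalForm a b (c′ ∷ cs)) ∎
    where
    factor : ∀ p q a b c P F → p * c * (a * P) + b * (q * c * P + (p * a + q * b) * F)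
                               ≡ (p * a + q * b) * (c * P + b * F)
    factor = solve-∀

  linearPower : ℤ → ℤ → (m : ℕ) → ℤ → Vec ℤ (suc m)
  linearPower p q zero    g = g ∷ []
  linearPower p q (suc m) g = mulLinear p q (linearPower p q m g)

  evalForm-linearPower : ∀ a b p q m g →
                         evalForm a b (linearPower p q m g) ≡ (p * a + q * b) ^ m * g
  evalForm-linearPower a b p q zero    g = constant g b
    where
    constant : ∀ g b → g * 1ℤ + b * 0ℤ ≡ 1ℤ * g
    constant = solve-∀
  evalForm-linearPower a b p q (suc m) g = begin
    evalForm a b (mulLinear p q (linearPower p q m g))
      ≡⟨ evalForm-mulLinear a b p q (linearPower p q m g) ⟩
    (p * a + q * b) * evalForm a b (linearPower p q m g)
      ≡⟨ cong ((p * a + q * b) *_) (evalForm-linearPower a b p q m g) ⟩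
    (p * a + q * b) * ((p * a + q * b) ^ m * g)
      ≡⟨ *-assoc (p * a + q * b) ((p * a + q * b) ^ m) g ⟨
    (p * a + q * b) ^ suc m * g ∎

module ScaledValue where

  open import Data.Nat.Base as ℕ using (ℕ; zero; suc; _≤_; s≤s; _∸_)
  import Data.Nat.Properties as ℕ
  import Data.Nat.Divisibility as ℕ
  open import Data.Nat.Coprimality as ℕ using (coprime-Bézout; recompute)
  open import Data.Nat.GCD using (module Bézout)
  open import Data.Integer.Base as ℤ using (ℤ; +_; 0ℤ; 1ℤ; _+_; _*_; -_; _^_; NonZero)
  import Data.Integer.Properties as ℤ
  import Data.Integer.Coprimality as ℤ
  open import Data.Integer.Divisibility as ℤ using ()
  open import Data.Integer.Divisibility.Signed using (divides; ∣⇒∣ᵤ)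
  open import Data.Integer.DivMod using (_/_; _%_; a≡a%n+[a/n]*n; n%d<d)
  open import Data.Integer.Tactic.RingSolver using (solve-∀)
  open import Data.Rational.Base as ℚ using (ℚ; mkℚ; ↥_; ↧_; ↧ₙ_; *≡*)
  import Data.Rational.Properties as ℚ
  open import Data.Vec.Base using (Vec; []; _∷_; zipWith; replicate)
  open import Data.List.Base using (List; []; _∷_; length)
  open import Data.List.Relation.Unary.All as All using (All; []; _∷_)
  open import Data.List.Relation.Unary.Any using (here; there)
  open import Data.List.Membership.DecPropositional ℚ._≟_ using (_∈_; _∉_; _∈?_)
  open import Data.Product.Base using (Σ; ∃₂; _×_; _,_)
  open import Data.Sum.Base using (_⊎_; inj₁; inj₂)
  open import Data.Empty using (⊥)
  open import Relation.Nullary.Decidable using (yes; no)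
  open import Relation.Binary.PropositionalEquality
  open ≡-Reasoning
  open import Defs using (Monic)
  open BinaryForm

  private variable
    m n : ℕ
    x y : ℚ
    xs : List ℚ

  formAt : ℚ → Vec ℤ m → ℤ
  formAt x = evalForm (↥ x) (↧ x)

  -- The integer ↧ x ^ n · P(x) (see ↧^n*evalMonic≡scaledValue).
  scaledValue : Monic n → ℚ → ℤ
  scaledValue {n} P x = ↥ x ^ n + ↧ x * formAt x P

  scaledValue-zipWith-+ : ∀ (P Q : Monic n) y →
                          scaledValue (zipWith _+_ P Q) y ≡ scaledValue P y + ↧ y * formAt y Q
  scaledValue-zipWith-+ {n} P Q y = begin
    ↥ y ^ n + ↧ y * formAt y (zipWith _+_ P Q)
      ≡⟨ cong (λ t → ↥ y ^ n + ↧ y * t) (evalForm-zipWith-+ (↥ y) (↧ y) P Q) ⟩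
    ↥ y ^ n + ↧ y * (formAt y P + formAt y Q)
      ≡⟨ distrib (↥ y ^ n) (↧ y) (formAt y P) (formAt y Q) ⟩
    scaledValue P y + ↧ y * formAt y Q ∎
    where
    distrib : ∀ a b p q → a + b * (p + q) ≡ (a + b * p) + b * q
    distrib = solve-∀

  -- The value at y of the linear form ↧ x · X − ↥ x · Y, which vanishes at x.
  cross : ℚ → ℚ → ℤ
  cross x y = ↧ x * ↥ y + (- ↥ x) * ↧ y

  cross-self : ∀ x → cross x x ≡ 0ℤ
  cross-self x = cancel (↧ x) (↥ x)
    where
    cancel : ∀ b a → b * a + (- a) * b ≡ 0ℤ
    cancel = solve-∀

  cross≡0⇒≡ : cross x y ≡ 0ℤ → x ≡ y
  cross≡0⇒≡ {x} {y} eq = ℚ.≃⇒≡ (*≡* (sym (begin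
    ↥ y * ↧ x               ≡⟨ rearrange (↧ x) (↥ x) (↥ y) (↧ y) ⟩
    cross x y + ↥ x * ↧ y   ≡⟨ cong (_+ ↥ x * ↧ y) eq ⟩
    0ℤ + ↥ x * ↧ y          ≡⟨ ℤ.+-identityˡ (↥ x * ↧ y) ⟩
    ↥ x * ↧ y               ∎)))
    where
    rearrange : ∀ b a c d → c * b ≡ (b * c + (- a) * d) + a * d
    rearrange = solve-∀

  ∏cross : List ℚ → ℚ → ℤ
  ∏cross []       y = 1ℤ
  ∏cross (x ∷ xs) y = cross x y * ∏cross xs y

  ∈⇒∏cross≡0 : y ∈ xs → ∏cross xs y ≡ 0ℤ
  ∈⇒∏cross≡0 {y} {_ ∷ xs} (here refl)   = cong (_* ∏cross xs y) (cross-self y)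
  ∈⇒∏cross≡0 {y} {x ∷ _}  (there y∈xs) =
    trans (cong (cross x y *_) (∈⇒∏cross≡0 y∈xs)) (ℤ.*-zeroʳ (cross x y))

  ∏cross≡0⇒∈ : ∀ xs → ∏cross xs y ≡ 0ℤ → y ∈ xs
  ∏cross≡0⇒∈ {y} (x ∷ xs) eq with ℤ.i*j≡0⇒i≡0∨j≡0 (cross x y) eq
  ... | inj₁ cross≡0 = here (sym (cross≡0⇒≡ cross≡0))
  ... | inj₂ ∏≡0     = there (∏cross≡0⇒∈ xs ∏≡0)

  ↧*∏cross≢0 : ∀ xs → y ∉ xs → NonZero (↧ y * ∏cross xs y)
  ↧*∏cross≢0 {y} xs y∉xs = ℤ.≢-nonZero λ eq → factor≡0 (ℤ.i*j≡0⇒i≡0∨j≡0 (↧ y) eq)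
    where
    factor≡0 : ↧ y ≡ 0ℤ ⊎ ∏cross xs y ≡ 0ℤ → ⊥
    factor≡0 (inj₁ ())
    factor≡0 (inj₂ ∏≡0) = y∉xs (∏cross≡0⇒∈ xs ∏≡0)

  mulFactors : (xs : List ℚ) → length xs ≤ m → Vec ℤ (suc (m ∸ length xs)) → Vec ℤ (suc m)
  mulFactors []       _       F = F
  mulFactors (x ∷ xs) (s≤s h) F = mulLinear (↧ x) (- ↥ x) (mulFactors xs h F)

  formAt-mulFactors : ∀ xs (h : length xs ≤ m) F y →
                      formAt y (mulFactors xs h F) ≡ ∏cross xs y * formAt y F
  formAt-mulFactors []       _       F y = sym (ℤ.*-identityˡ (formAt y F))
  formAt-mulFactors (x ∷ xs) (s≤s h) F y = begin
    formAt y (mulLinear (↧ x) (- ↥ x) (mulFactors xs h F))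
      ≡⟨ evalForm-mulLinear (↥ y) (↧ y) (↧ x) (- ↥ x) (mulFactors xs h F) ⟩
    cross x y * formAt y (mulFactors xs h F)
      ≡⟨ cong (cross x y *_) (formAt-mulFactors xs h F y) ⟩
    cross x y * (∏cross xs y * formAt y F)
      ≡⟨ ℤ.*-assoc (cross x y) (∏cross xs y) (formAt y F) ⟨
    ∏cross (x ∷ xs) y * formAt y F ∎

  lift-1+*≡* : ∀ {s t p q} → 1 ℕ.+ s ℕ.* t ≡ p ℕ.* q → 1ℤ + + s * + t ≡ + p * + q
  lift-1+*≡* {s} {t} {p} {q} eq = begin
    1ℤ + + s * + t     ≡⟨ cong (_+_ 1ℤ) (ℤ.pos-* s t) ⟨
    + (1 ℕ.+ s ℕ.* t)  ≡⟨ cong +_ eq ⟩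
    + (p ℕ.* q)        ≡⟨ ℤ.pos-* p q ⟩
    + p * + q          ∎

  ℕ-bézout : ∀ {a b} → ℕ.Coprime a b → ∃₂ λ u v → u * + a + v * + b ≡ 1ℤ
  ℕ-bézout {a} {b} coprime with coprime-Bézout coprime
  ... | Bézout.+- u v eq = + u , - + v , (begin
    + u * + a + (- + v) * + b         ≡⟨ cong (_+ (- + v) * + b) (lift-1+*≡* {v} {b} {u} {a} eq) ⟨
    (1ℤ + + v * + b) + (- + v) * + b  ≡⟨ cancel 1ℤ (+ v) (+ b) ⟩
    1ℤ                                ∎)
    where
    cancel : ∀ o s t → (o + s * t) + (- s) * t ≡ o
    cancel = solve-∀
  ... | Bézout.-+ u v eq = - + u , + v , (begin
    (- + u) * + a + + v * + b         ≡⟨ cong (_+_ ((- + u) * + a)) (lift-1+*≡* {u} {a} {v} {b} eq) ⟨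
    (- + u) * + a + (1ℤ + + u * + a)  ≡⟨ cancel 1ℤ (+ u) (+ a) ⟩
    1ℤ                                ∎)
    where
    cancel : ∀ o s t → (- s) * t + (o + s * t) ≡ o
    cancel = solve-∀

  bézout : ∀ x → ∃₂ λ u v → u * ↥ x + v * ↧ x ≡ 1ℤ
  bézout x@(mkℚ _ _ coprime) with ℕ-bézout (recompute coprime) | ℤ.+∣i∣≡i⊎+∣i∣≡-i (↥ x)
  ... | u , v , eq | inj₁ ∣↥x∣≡↥x = u , v , subst (λ t → u * t + v * ↧ x ≡ 1ℤ) ∣↥x∣≡↥x eq
  ... | u , v , eq | inj₂ ∣↥x∣≡-↥x = - u , v , (begin
    (- u) * ↥ x + v * ↧ x      ≡⟨ cong (_+ v * ↧ x) (neg-swap u (↥ x)) ⟩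
    u * (- ↥ x) + v * ↧ x      ≡⟨ cong (λ t → u * t + v * ↧ x) ∣↥x∣≡-↥x ⟨
    u * + ℤ.∣ ↥ x ∣ + v * ↧ x  ≡⟨ eq ⟩
    1ℤ                         ∎)
    where
    neg-swap : ∀ u a → (- u) * a ≡ u * (- a)
    neg-swap = solve-∀

  formWithValue : ℚ → ℤ → (m : ℕ) → Vec ℤ (suc m)
  formWithValue x g m with bézout x
  ... | u , v , _ = linearPower u v m g

  formAt-formWithValue : ∀ x g m → formAt x (formWithValue x g m) ≡ g
  formAt-formWithValue x g m with bézout x
  ... | u , v , eq = begin
    formAt x (linearPower u v m g)  ≡⟨ evalForm-linearPower (↥ x) (↧ x) u v m g ⟩
    (u * ↥ x + v * ↧ x) ^ m * g     ≡⟨ cong (λ t → t ^ m * g) eq ⟩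
    1ℤ ^ m * g                      ≡⟨ cong (_* g) (ℤ.^-zeroˡ m) ⟩
    1ℤ * g                          ≡⟨ ℤ.*-identityˡ g ⟩
    g                               ∎

  a+n*-[a/n]≡a%n : ∀ a n .{{_ : NonZero n}} → a + n * (- (a / n)) ≡ + (a % n)
  a+n*-[a/n]≡a%n a n = begin
    a + n * (- (a / n))                          ≡⟨ cong (λ t → t + n * (- (a / n))) (a≡a%n+[a/n]*n a n) ⟩
    (+ (a % n) + (a / n) * n) + n * (- (a / n))  ≡⟨ cancel (+ (a % n)) (a / n) n ⟩
    + (a % n)                                    ∎
    where
    cancel : ∀ r q n → (r + q * n) + n * (- q) ≡ r
    cancel = solve-∀

  -- The added form vanishes on xs and takes the value ∏cross xs r · g at r, so a suitable g
  -- replaces the scaled value at r by its remainder modulo ↧ r · ∏cross xs r.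
  correctAt : (xs : List ℚ) (r : ℚ) → r ∉ xs → length xs ≤ m → (P : Monic (suc m)) →
              Σ (Monic (suc m)) λ P′ → (∀ {y} → y ∈ xs → scaledValue P′ y ≡ scaledValue P y)
                                      × ℤ.∣ scaledValue P′ r ∣ ℕ.< ℤ.∣ ↧ r * ∏cross xs r ∣
  correctAt {m} xs r r∉xs h P =
    zipWith _+_ P W , unchanged , subst (ℕ._< ℤ.∣ d ∣) (cong ℤ.∣_∣ (sym reduced)) (n%d<d t d)
    where
    d = ↧ r * ∏cross xs r
    instance _ = ↧*∏cross≢0 xs r∉xs
    t = scaledValue P r
    g = - (t / d)
    F = formWithValue r g (m ∸ length xs)
    W = mulFactors xs h F

    scaledValue-W : ∀ y → scaledValue (zipWith _+_ P W) y
                          ≡ scaledValue P y + ↧ y * (∏cross xs y * formAt y F)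
    scaledValue-W y = trans (scaledValue-zipWith-+ P W y)
                            (cong (λ s → scaledValue P y + ↧ y * s) (formAt-mulFactors xs h F y))

    unchanged : ∀ {y} → y ∈ xs → scaledValue (zipWith _+_ P W) y ≡ scaledValue P y
    unchanged {y} y∈xs = begin
      scaledValue (zipWith _+_ P W) y                     ≡⟨ scaledValue-W y ⟩
      scaledValue P y + ↧ y * (∏cross xs y * formAt y F)
        ≡⟨ cong (λ s → scaledValue P y + ↧ y * (s * formAt y F)) (∈⇒∏cross≡0 y∈xs) ⟩
      scaledValue P y + ↧ y * (0ℤ * formAt y F)           ≡⟨ vanish (scaledValue P y) (↧ y) (formAt y F) ⟩
      scaledValue P y                                     ∎
      where
      vanish : ∀ s b f → s + b * (0ℤ * f) ≡ s
      vanish = solve-∀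

    reduced : scaledValue (zipWith _+_ P W) r ≡ + (t % d)
    reduced = begin
      scaledValue (zipWith _+_ P W) r       ≡⟨ scaledValue-W r ⟩
      t + ↧ r * (∏cross xs r * formAt r F)
        ≡⟨ cong (λ s → t + ↧ r * (∏cross xs r * s)) (formAt-formWithValue r g (m ∸ length xs)) ⟩
      t + ↧ r * (∏cross xs r * g)           ≡⟨ cong (_+_ t) (ℤ.*-assoc (↧ r) (∏cross xs r) g) ⟨
      t + d * g                             ≡⟨ a+n*-[a/n]≡a%n t d ⟩
      + (t % d)                             ∎

  residueBound : List ℚ → ℕ
  residueBound []       = 0
  residueBound (r ∷ xs) = ℤ.∣ ↧ r * ∏cross xs r ∣ ℕ.+ residueBound xs

  scaledValues-bounded : (xs : List ℚ) → length xs ≤ n →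
                         Σ (Monic n) λ P → All (λ x → ℤ.∣ scaledValue P x ∣ ≤ residueBound xs) xs
  scaledValues-bounded {n} [] _ = replicate n 0ℤ , []
  scaledValues-bounded (r ∷ xs) (s≤s h) with scaledValues-bounded xs (ℕ.m≤n⇒m≤1+n h) | r ∈? xs
  ... | P , bounded | yes r∈xs = P , All.lookup bounded′ r∈xs ∷ bounded′
    where bounded′ = All.map (ℕ.m≤n⇒m≤o+n ℤ.∣ ↧ r * ∏cross xs r ∣) bounded
  ... | P , bounded | no r∉xs =
    let P′ , unchanged , reduced = correctAt xs r r∉xs h P in
    P′ , ℕ.m≤n⇒m≤n+o (residueBound xs) (ℕ.<⇒≤ reduced) ∷ All.tabulate λ y∈xs →
      ℕ.m≤n⇒m≤o+n ℤ.∣ ↧ r * ∏cross xs r ∣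
        (subst (λ s → ℤ.∣ s ∣ ≤ residueBound xs) (sym (unchanged y∈xs)) (All.lookup bounded y∈xs))

  coprime-∣^⇒∣1 : ∀ i j n → ℤ.Coprime i j → i ℤ.∣ j ^ n → i ℤ.∣ 1ℤ
  coprime-∣^⇒∣1 i j zero    _        i∣1       = i∣1
  coprime-∣^⇒∣1 i j (suc n) coprime i∣j^[1+n] =
    coprime-∣^⇒∣1 i j n coprime (ℤ.coprime-divisor i j (j ^ n) coprime i∣j^[1+n])

  scaledValue≢0 : ∀ (P : Monic n) x → 2 ≤ ↧ₙ x → scaledValue P x ≢ 0ℤ
  scaledValue≢0 {n} P x@(mkℚ a c coprime) 2≤↧x eq =
    ℕ.<-irrefl refl (subst (2 ≤_) (ℕ.∣1⇒≡1 ↧x∣1) 2≤↧x)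
    where
    ↧x∣↥x^n : ↧ x ℤ.∣ ↥ x ^ n
    ↧x∣↥x^n = ∣⇒∣ᵤ (divides (- formAt x P) (begin
      a ^ n                                    ≡⟨ rearrange (a ^ n) (↧ x) (formAt x P) ⟩
      scaledValue P x + (- formAt x P) * ↧ x   ≡⟨ cong (_+ (- formAt x P) * ↧ x) eq ⟩
      0ℤ + (- formAt x P) * ↧ x                ≡⟨ ℤ.+-identityˡ ((- formAt x P) * ↧ x) ⟩
      (- formAt x P) * ↧ x                     ∎))
      where
      rearrange : ∀ s b f → s ≡ (s + b * f) + (- f) * b
      rearrange = solve-∀
    ↧x∣1 : ↧ₙ x ℕ.∣ 1
    ↧x∣1 = coprime-∣^⇒∣1 (↧ x) (↥ x) n (ℕ.sym (recompute coprime)) ↧x∣↥x^n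

open import Data.Nat.Base as ℕ using (ℕ; zero; suc; z≤n; s≤s; _≤_)
import Data.Nat.Properties as ℕ
open import Data.Nat.Coprimality using (Coprime)
open import Data.Integer.Base as ℤ using (ℤ; +_; +[1+_]; -[1+_]; 1ℤ)
import Data.Integer.Properties as ℤ
open import Data.Integer.Tactic.RingSolver using (solve-∀)
open import Data.Rational.Base as ℚ
  using ( ℚ; mkℚ; ↥_; ↧_; ↧ₙ_; nonNegative; 0ℚ; 1ℚ; _+_; _*_; _-_; -_; _/_; _<_; _⊔_; ∣_∣
        ; toℚᵘ; *<*)
import Data.Rational.Properties as ℚ
open import Data.Rational.Solver using (module +-*-Solver)
open import Data.Rational.Unnormalised.Base as ℚᵘ using (mkℚᵘ; _≃_; *≡*)
import Data.Rational.Unnormalised.Properties as ℚᵘ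
open import Data.Fin.Base using (Fin; zero; suc)
open import Data.Vec.Base using (Vec; []; _∷_)
open import Data.List.Base using (List; []; _∷_; map; length) renaming (tabulate to tab)
import Data.List.Properties as List
open import Data.List.Relation.Unary.All as All using (All; []; _∷_)
import Data.List.Relation.Unary.All.Properties as All
open import Data.List.Relation.Unary.Any using (here; there)
open import Data.List.Membership.Propositional using (_∈_)
open import Data.List.Membership.Propositional.Properties using (∈-map⁺; ∈-map⁻)
open import Data.Product.Base using (Σ; ∃; _×_; _,_)
open import Data.Sum.Base using (inj₁; inj₂)
open import Function.Base using (_∘_)
open import Relation.Binary.PropositionalEquality
open import Defs
open ScaledValue using (formAt; scaledValue; scaledValue≢0; residueBound; scaledValues-bounded)

private variable
  m n : ℕ
  p q r y δ ε : ℚ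

ι : ℤ → ℚ
ι i = i / 1

toℚᵘ-ι : ∀ i → toℚᵘ (ι i) ≃ mkℚᵘ i 0
toℚᵘ-ι i = ℚ.toℚᵘ-fromℚᵘ (mkℚᵘ i 0)

ι-+ : ∀ i j → ι (i ℤ.+ j) ≡ ι i + ι j
ι-+ i j = ℚ.toℚᵘ-injective (begin
  toℚᵘ (ι (i ℤ.+ j))           ≈⟨ toℚᵘ-ι (i ℤ.+ j) ⟩
  mkℚᵘ (i ℤ.+ j) 0             ≈⟨ *≡* (unit i j) ⟩
  mkℚᵘ i 0 ℚᵘ.+ mkℚᵘ j 0       ≈⟨ ℚᵘ.+-cong (toℚᵘ-ι i) (toℚᵘ-ι j) ⟨
  toℚᵘ (ι i) ℚᵘ.+ toℚᵘ (ι j)   ≈⟨ ℚ.toℚᵘ-homo-+ (ι i) (ι j) ⟨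
  toℚᵘ (ι i + ι j)             ∎)
  where
  open ℚᵘ.≃-Reasoning
  unit : ∀ i j → (i ℤ.+ j) ℤ.* 1ℤ ≡ (i ℤ.* 1ℤ ℤ.+ j ℤ.* 1ℤ) ℤ.* 1ℤ
  unit = solve-∀

ι-* : ∀ i j → ι (i ℤ.* j) ≡ ι i * ι j
ι-* i j = ℚ.toℚᵘ-injective (begin
  toℚᵘ (ι (i ℤ.* j))           ≈⟨ toℚᵘ-ι (i ℤ.* j) ⟩
  mkℚᵘ i 0 ℚᵘ.* mkℚᵘ j 0       ≈⟨ ℚᵘ.*-cong (toℚᵘ-ι i) (toℚᵘ-ι j) ⟨
  toℚᵘ (ι i) ℚᵘ.* toℚᵘ (ι j)   ≈⟨ ℚ.toℚᵘ-homo-* (ι i) (ι j) ⟨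
  toℚᵘ (ι i * ι j)             ∎)
  where open ℚᵘ.≃-Reasoning

ι-^ : ∀ i n → ι (i ℤ.^ n) ≡ ι i ^ℚ n
ι-^ i zero    = refl
ι-^ i (suc n) = trans (ι-* i (i ℤ.^ n)) (cong (ι i *_) (ι-^ i n))

ι-mono-≤ : ∀ {i j} → i ℤ.≤ j → ι i ℚ.≤ ι j
ι-mono-≤ {i} {j} i≤j = ℚ.toℚᵘ-cancel-≤ (ℚᵘ.≤-respˡ-≃ (ℚᵘ.≃-sym (toℚᵘ-ι i))
  (ℚᵘ.≤-respʳ-≃ (ℚᵘ.≃-sym (toℚᵘ-ι j)) (ℚᵘ.*≤* (ℤ.*-monoʳ-≤-nonNeg 1ℤ i≤j))))

0≤ι : ∀ n → 0ℚ ℚ.≤ ι (+ n)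
0≤ι n = ι-mono-≤ {+ 0} {+ n} (ℤ.+≤+ z≤n)

∣ι∣ : ∀ i → ∣ ι i ∣ ≡ ι (+ ℤ.∣ i ∣)
∣ι∣ (+ n)    = ℚ.0≤p⇒∣p∣≡p (0≤ι n)
∣ι∣ -[1+ n ] = trans (ℚ.∣-p∣≡∣p∣ (ι +[1+ n ])) (ℚ.0≤p⇒∣p∣≡p (0≤ι (suc n)))

ι[1+c]*[i/1+c]≡ι[i] : ∀ i c → ι (+ suc c) * (i / suc c) ≡ ι i
ι[1+c]*[i/1+c]≡ι[i] i c = ℚ.toℚᵘ-injective (begin
  toℚᵘ (ι (+ suc c) * (i / suc c))          ≈⟨ ℚ.toℚᵘ-homo-* (ι (+ suc c)) (i / suc c) ⟩
  toℚᵘ (ι (+ suc c)) ℚᵘ.* toℚᵘ (i / suc c)  ≈⟨ ℚᵘ.*-cong (toℚᵘ-ι (+ suc c)) (ℚ.toℚᵘ-fromℚᵘ (mkℚᵘ i c)) ⟩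
  mkℚᵘ (+ suc c) 0 ℚᵘ.* mkℚᵘ i c           ≈⟨ *≡* cancel ⟩
  mkℚᵘ i 0                                  ≈⟨ toℚᵘ-ι i ⟨
  toℚᵘ (ι i)                                ∎)
  where
  open ℚᵘ.≃-Reasoning
  cancel : (+ suc c ℤ.* i) ℤ.* 1ℤ ≡ i ℤ.* + suc (c ℕ.+ 0)
  cancel = trans (comm (+ suc c) i) (cong (λ d → i ℤ.* + suc d) (sym (ℕ.+-identityʳ c)))
    where
    comm : ∀ b i → (b ℤ.* i) ℤ.* 1ℤ ≡ i ℤ.* b
    comm = solve-∀

1/↧ : ℚ → ℚ
1/↧ x = + 1 / ↧ₙ x

↧*≡↥ : ∀ x → ι (↧ x) * x ≡ ι (↥ x)
↧*≡↥ x = trans (cong (ι (↧ x) *_) (sym (ℚ.↥p/↧p≡p x)))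
               (ι[1+c]*[i/1+c]≡ι[i] (↥ x) (ℚ.denominator-1 x))

↧*1/↧≡1 : ∀ x → ι (↧ x) * 1/↧ x ≡ 1ℚ
↧*1/↧≡1 x = ι[1+c]*[i/1+c]≡ι[i] (+ 1) (ℚ.denominator-1 x)

0≤1/↧ : ∀ x → 0ℚ ℚ.≤ 1/↧ x
0≤1/↧ x = ℚ.nonNegative⁻¹ (1/↧ x) {{ℚ.normalize-nonNeg 1 (↧ₙ x)}}

1/↧≤1 : ∀ x → 1/↧ x ℚ.≤ 1ℚ
1/↧≤1 x = ℚ.toℚᵘ-cancel-≤ (ℚᵘ.≤-respˡ-≃ 1/↧≃ (ℚᵘ.*≤* (ℤ.+≤+ (s≤s z≤n))))
  where
  1/↧≃ : mkℚᵘ (+ 1) (ℚ.denominator-1 x) ≃ toℚᵘ (1/↧ x)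
  1/↧≃ = ℚᵘ.≃-sym (ℚ.toℚᵘ-fromℚᵘ (mkℚᵘ (+ 1) (ℚ.denominator-1 x)))

^ℚ-distribʳ-* : ∀ p q n → (p * q) ^ℚ n ≡ p ^ℚ n * q ^ℚ n
^ℚ-distribʳ-* p q zero    = refl
^ℚ-distribʳ-* p q (suc n) = trans (cong ((p * q) *_) (^ℚ-distribʳ-* p q n)) (swap p q (p ^ℚ n) (q ^ℚ n))
  where
  open +-*-Solver
  swap : ∀ p q s t → (p * q) * (s * t) ≡ (p * s) * (q * t)
  swap = solve 4 (λ p q s t → (p :* q) :* (s :* t) := (p :* s) :* (q :* t)) refl

1^ℚ≡1 : ∀ n → 1ℚ ^ℚ n ≡ 1ℚ
1^ℚ≡1 zero    = refl
1^ℚ≡1 (suc n) = trans (ℚ.*-identityˡ (1ℚ ^ℚ n)) (1^ℚ≡1 n)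

*-monoˡ-≤-0≤ : 0ℚ ℚ.≤ r → p ℚ.≤ q → r * p ℚ.≤ r * q
*-monoˡ-≤-0≤ {r} 0≤r = ℚ.*-monoˡ-≤-nonNeg r {{nonNegative 0≤r}}

*-monoʳ-≤-0≤ : 0ℚ ℚ.≤ r → p ℚ.≤ q → p * r ℚ.≤ q * r
*-monoʳ-≤-0≤ {r} 0≤r = ℚ.*-monoʳ-≤-nonNeg r {{nonNegative 0≤r}}

0≤* : 0ℚ ℚ.≤ p → 0ℚ ℚ.≤ q → 0ℚ ℚ.≤ p * q
0≤* {p} 0≤p 0≤q = ℚ.≤-trans (ℚ.≤-reflexive (sym (ℚ.*-zeroʳ p))) (*-monoˡ-≤-0≤ 0≤p 0≤q)

p≤p+q : 0ℚ ℚ.≤ q → p ℚ.≤ p + q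
p≤p+q {q} {p} 0≤q = ℚ.≤-trans (ℚ.≤-reflexive (sym (ℚ.+-identityʳ p))) (ℚ.+-monoʳ-≤ p 0≤q)

p≤q+p : 0ℚ ℚ.≤ q → p ℚ.≤ q + p
p≤q+p {q} {p} 0≤q = ℚ.≤-trans (p≤p+q 0≤q) (ℚ.≤-reflexive (ℚ.+-comm p q))

0≤^ℚ : ∀ n → 0ℚ ℚ.≤ p → 0ℚ ℚ.≤ p ^ℚ n
0≤^ℚ zero    _   = ℚ.nonNegative⁻¹ 1ℚ
0≤^ℚ (suc n) 0≤p = 0≤* 0≤p (0≤^ℚ n 0≤p)

^ℚ-monoˡ-≤ : ∀ n → 0ℚ ℚ.≤ p → p ℚ.≤ q → p ^ℚ n ℚ.≤ q ^ℚ n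
^ℚ-monoˡ-≤ zero    _   _   = ℚ.≤-refl
^ℚ-monoˡ-≤ (suc n) 0≤p p≤q = ℚ.≤-trans (*-monoʳ-≤-0≤ (0≤^ℚ n 0≤p) p≤q)
                                        (*-monoˡ-≤-0≤ (ℚ.≤-trans 0≤p p≤q) (^ℚ-monoˡ-≤ n 0≤p p≤q))

ι-horner : ∀ c a m b f → ι (c ℤ.* a ℤ.^ m ℤ.+ b ℤ.* f) ≡ ι c * ι a ^ℚ m + ι b * ι f
ι-horner c a m b f = trans (ι-+ (c ℤ.* a ℤ.^ m) (b ℤ.* f))
  (cong₂ _+_ (trans (ι-* c (a ℤ.^ m)) (cong (ι c *_) (ι-^ a m))) (ι-* b f))

↧^m*evalAcc : ∀ acc (cs : Vec ℤ m) x →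
              ι (↧ x) ^ℚ m * evalAcc acc cs x ≡ acc * ι (↥ x) ^ℚ m + ι (↧ x) * ι (formAt x cs)
↧^m*evalAcc acc [] x = base acc (ι (↧ x))
  where
  open +-*-Solver
  base : ∀ acc b → 1ℚ * acc ≡ acc * 1ℚ + b * 0ℚ
  base = solve 2 (λ acc b → con 1ℚ :* acc := acc :* con 1ℚ :+ b :* con 0ℚ) refl
↧^m*evalAcc {suc m} acc (c ∷ cs) x = begin
  (B * B ^ℚ m) * evalAcc (acc * x + ι c) cs x
    ≡⟨ ℚ.*-assoc B (B ^ℚ m) (evalAcc (acc * x + ι c) cs x) ⟩
  B * (B ^ℚ m * evalAcc (acc * x + ι c) cs x)
    ≡⟨ cong (B *_) (↧^m*evalAcc (acc * x + ι c) cs x) ⟩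
  B * ((acc * x + ι c) * A ^ℚ m + B * ι F)
    ≡⟨ expand B acc x (ι c) (A ^ℚ m) (ι F) ⟩
  acc * ((B * x) * A ^ℚ m) + B * (ι c * A ^ℚ m + B * ι F)
    ≡⟨ cong (λ t → acc * (t * A ^ℚ m) + B * (ι c * A ^ℚ m + B * ι F)) (↧*≡↥ x) ⟩
  acc * (A * A ^ℚ m) + B * (ι c * A ^ℚ m + B * ι F)
    ≡⟨ cong (λ t → acc * (A * A ^ℚ m) + B * t) (ι-horner c (↥ x) m (↧ x) F) ⟨
  acc * (A * A ^ℚ m) + B * ι (formAt x (c ∷ cs)) ∎
  where
  open ≡-Reasoning
  open +-*-Solver
  A = ι (↥ x)
  B = ι (↧ x)
  F = formAt x cs
  expand : ∀ b acc x c p f → b * ((acc * x + c) * p + b * f) ≡ acc * ((b * x) * p) + b * (c * p + b * f)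
  expand = solve 6 (λ b acc x c p f → b :* ((acc :* x :+ c) :* p :+ b :* f)
                                    := acc :* ((b :* x) :* p) :+ b :* (c :* p :+ b :* f)) refl

↧^n*evalMonic≡scaledValue : ∀ (P : Monic n) x → ι (↧ x) ^ℚ n * evalMonic P x ≡ ι (scaledValue P x)
↧^n*evalMonic≡scaledValue {n} P x = begin
  ι (↧ x) ^ℚ n * evalMonic P x
    ≡⟨ ↧^m*evalAcc 1ℚ P x ⟩
  1ℚ * ι (↥ x) ^ℚ n + ι (↧ x) * ι (formAt x P)
    ≡⟨ cong (_+ ι (↧ x) * ι (formAt x P)) (ℚ.*-identityˡ (ι (↥ x) ^ℚ n)) ⟩
  ι (↥ x) ^ℚ n + ι (↧ x) * ι (formAt x P)
    ≡⟨ cong₂ _+_ (ι-^ (↥ x) n) (ι-* (↧ x) (formAt x P)) ⟨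
  ι (↥ x ℤ.^ n) + ι (↧ x ℤ.* formAt x P)
    ≡⟨ ι-+ (↥ x ℤ.^ n) (↧ x ℤ.* formAt x P) ⟨
  ι (scaledValue P x) ∎
  where open ≡-Reasoning

evalMonic≡1/↧^n*scaledValue : ∀ (P : Monic n) x → evalMonic P x ≡ 1/↧ x ^ℚ n * ι (scaledValue P x)
evalMonic≡1/↧^n*scaledValue {n} P x = begin
  evalMonic P x
    ≡⟨ ℚ.*-identityˡ (evalMonic P x) ⟨
  1ℚ * evalMonic P x
    ≡⟨ cong (_* evalMonic P x) (1^ℚ≡1 n) ⟨
  1ℚ ^ℚ n * evalMonic P x
    ≡⟨ cong (λ t → t ^ℚ n * evalMonic P x) (trans (ℚ.*-comm (1/↧ x) (ι (↧ x))) (↧*1/↧≡1 x)) ⟨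
  (1/↧ x * ι (↧ x)) ^ℚ n * evalMonic P x
    ≡⟨ cong (_* evalMonic P x) (^ℚ-distribʳ-* (1/↧ x) (ι (↧ x)) n) ⟩
  (1/↧ x ^ℚ n * ι (↧ x) ^ℚ n) * evalMonic P x
    ≡⟨ ℚ.*-assoc (1/↧ x ^ℚ n) (ι (↧ x) ^ℚ n) (evalMonic P x) ⟩
  1/↧ x ^ℚ n * (ι (↧ x) ^ℚ n * evalMonic P x)
    ≡⟨ cong (1/↧ x ^ℚ n *_) (↧^n*evalMonic≡scaledValue P x) ⟩
  1/↧ x ^ℚ n * ι (scaledValue P x) ∎
  where open ≡-Reasoning

∣evalMonic∣≡1/↧^n*∣scaledValue∣ : ∀ (P : Monic n) x →
                                   ∣ evalMonic P x ∣ ≡ 1/↧ x ^ℚ n * ι (+ ℤ.∣ scaledValue P x ∣)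
∣evalMonic∣≡1/↧^n*∣scaledValue∣ {n} P x = begin
  ∣ evalMonic P x ∣
    ≡⟨ cong ∣_∣ (evalMonic≡1/↧^n*scaledValue P x) ⟩
  ∣ 1/↧ x ^ℚ n * ι (scaledValue P x) ∣
    ≡⟨ ℚ.∣p*q∣≡∣p∣*∣q∣ (1/↧ x ^ℚ n) (ι (scaledValue P x)) ⟩
  ∣ 1/↧ x ^ℚ n ∣ * ∣ ι (scaledValue P x) ∣
    ≡⟨ cong₂ _*_ (ℚ.0≤p⇒∣p∣≡p (0≤^ℚ n (0≤1/↧ x))) (∣ι∣ (scaledValue P x)) ⟩
  1/↧ x ^ℚ n * ι (+ ℤ.∣ scaledValue P x ∣) ∎
  where open ≡-Reasoning

1/↧^n≤∣evalMonic∣ : ∀ (P : Monic n) x → 2 ≤ ↧ₙ x → 1/↧ x ^ℚ n ℚ.≤ ∣ evalMonic P x ∣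
1/↧^n≤∣evalMonic∣ {n} P x 2≤↧x = begin
  1/↧ x ^ℚ n                                 ≡⟨ ℚ.*-identityʳ (1/↧ x ^ℚ n) ⟨
  1/↧ x ^ℚ n * 1ℚ                            ≤⟨ *-monoˡ-≤-0≤ (0≤^ℚ n (0≤1/↧ x)) (ι-mono-≤ (ℤ.+≤+ 1≤∣s∣)) ⟩
  1/↧ x ^ℚ n * ι (+ ℤ.∣ scaledValue P x ∣)   ≡⟨ ∣evalMonic∣≡1/↧^n*∣scaledValue∣ P x ⟨
  ∣ evalMonic P x ∣                          ∎
  where
  open ℚ.≤-Reasoning
  1≤∣s∣ : 1 ≤ ℤ.∣ scaledValue P x ∣
  1≤∣s∣ = ℕ.n≢0⇒n>0 λ ∣s∣≡0 → scaledValue≢0 P x 2≤↧x (ℤ.∣i∣≡0⇒i≡0 ∣s∣≡0)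

∣evalMonic∣≤1/↧^n*K : ∀ (P : Monic n) x {K} → ℤ.∣ scaledValue P x ∣ ≤ K →
                      ∣ evalMonic P x ∣ ℚ.≤ 1/↧ x ^ℚ n * ι (+ K)
∣evalMonic∣≤1/↧^n*K {n} P x {K} ∣s∣≤K = begin
  ∣ evalMonic P x ∣                          ≡⟨ ∣evalMonic∣≡1/↧^n*∣scaledValue∣ P x ⟩
  1/↧ x ^ℚ n * ι (+ ℤ.∣ scaledValue P x ∣)   ≤⟨ *-monoˡ-≤-0≤ (0≤^ℚ n (0≤1/↧ x)) (ι-mono-≤ (ℤ.+≤+ ∣s∣≤K)) ⟩
  1/↧ x ^ℚ n * ι (+ K)                       ∎
  where open ℚ.≤-Reasoning

^ℚ-bernoulli : ∀ n → 0ℚ ℚ.≤ y → y ℚ.≤ 1ℚ → 0ℚ ℚ.≤ δ →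
               y ^ℚ n * (1ℚ + ι (+ n) * δ) ℚ.≤ (y + δ) ^ℚ n
^ℚ-bernoulli {y} {δ} zero _ _ _ = ℚ.≤-reflexive (trivial δ)
  where
  open +-*-Solver
  trivial : ∀ δ → 1ℚ * (1ℚ + 0ℚ * δ) ≡ 1ℚ
  trivial = solve 1 (λ δ → con 1ℚ :* (con 1ℚ :+ con 0ℚ :* δ) := con 1ℚ) refl
^ℚ-bernoulli {y} {δ} (suc n) 0≤y y≤1 0≤δ = begin
  y * Y * (1ℚ + ι (+ suc n) * δ)             ≡⟨ cong (λ t → y * Y * (1ℚ + t * δ)) (ι-+ (+ 1) (+ n)) ⟩
  y * Y * (1ℚ + (1ℚ + ι (+ n)) * δ)          ≤⟨ p≤p+q 0≤slack ⟩
  y * Y * (1ℚ + (1ℚ + ι (+ n)) * δ) + slack  ≡⟨ regroup y Y δ (ι (+ n)) ⟩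
  (y + δ) * (Y * (1ℚ + ι (+ n) * δ))         ≤⟨ *-monoˡ-≤-0≤ (ℚ.≤-trans 0≤y (p≤p+q 0≤δ))
                                                              (^ℚ-bernoulli n 0≤y y≤1 0≤δ) ⟩
  (y + δ) * (y + δ) ^ℚ n                     ∎
  where
  open ℚ.≤-Reasoning
  Y = y ^ℚ n
  slack = Y * δ * ((1ℚ - y) + ι (+ n) * δ)
  0≤slack : 0ℚ ℚ.≤ slack
  0≤slack = 0≤* (0≤* (0≤^ℚ n 0≤y) 0≤δ) (ℚ.≤-trans 0≤1-y (p≤p+q (0≤* (0≤ι n) 0≤δ)))
    where
    0≤1-y : 0ℚ ℚ.≤ 1ℚ - y
    0≤1-y = ℚ.≤-trans (ℚ.≤-reflexive (sym (ℚ.+-inverseʳ y))) (ℚ.+-monoˡ-≤ (- y) y≤1)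
  regroup : ∀ y Y δ m → y * Y * (1ℚ + (1ℚ + m) * δ) + Y * δ * ((1ℚ - y) + m * δ)
                        ≡ (y + δ) * (Y * (1ℚ + m * δ))
  regroup = solve 4 (λ y Y δ m → y :* Y :* (con 1ℚ :+ (con 1ℚ :+ m) :* δ)
                                   :+ Y :* δ :* ((con 1ℚ :- y) :+ m :* δ)
                                 := (y :+ δ) :* (Y :* (con 1ℚ :+ m :* δ))) refl
    where open +-*-Solver

0<⇒1≤↥ : 0ℚ < p → 1ℤ ℤ.≤ ↥ p
0<⇒1≤↥ {mkℚ +[1+ _ ] _ _} _                = ℤ.+≤+ (s≤s z≤n)
0<⇒1≤↥ {mkℚ (+ 0)    _ _} (*<* (ℤ.+<+ ()))
0<⇒1≤↥ {mkℚ -[1+ _ ] _ _} (*<* ())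

archimedean : 0ℚ < ε → ∀ K {n} → K ℕ.* ↧ₙ ε ≤ n → ι (+ K) ℚ.≤ ι (+ n) * ε
archimedean {ε} 0<ε K {n} K↧ε≤n = begin
  ι (+ K)                      ≡⟨ ℚ.*-identityʳ (ι (+ K)) ⟨
  ι (+ K) * 1ℚ                 ≤⟨ *-monoˡ-≤-0≤ (0≤ι K) (ι-mono-≤ (0<⇒1≤↥ 0<ε)) ⟩
  ι (+ K) * ι (↥ ε)            ≡⟨ cong (ι (+ K) *_) (↧*≡↥ ε) ⟨
  ι (+ K) * (ι (↧ ε) * ε)      ≡⟨ ℚ.*-assoc (ι (+ K)) (ι (↧ ε)) ε ⟨
  ι (+ K) * ι (↧ ε) * ε        ≡⟨ cong (_* ε) (trans (cong ι (ℤ.pos-* K (↧ₙ ε))) (ι-* (+ K) (↧ ε))) ⟨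
  ι (+ (K ℕ.* ↧ₙ ε)) * ε       ≤⟨ *-monoʳ-≤-0≤ (ℚ.<⇒≤ 0<ε) (ι-mono-≤ (ℤ.+≤+ K↧ε≤n)) ⟩
  ι (+ n) * ε                  ∎
  where open ℚ.≤-Reasoning

0≤maxList : ∀ xs → 0ℚ ℚ.≤ maxList xs
0≤maxList []       = ℚ.≤-refl
0≤maxList (x ∷ xs) = ℚ.≤-trans (0≤maxList xs) (ℚ.p≤q⊔p x (maxList xs))

maxList-lub : ∀ {xs} → 0ℚ ℚ.≤ r → All (ℚ._≤ r) xs → maxList xs ℚ.≤ r
maxList-lub 0≤r []           = 0≤r
maxList-lub 0≤r (x≤r ∷ xs≤r) = ℚ.⊔-lub x≤r (maxList-lub 0≤r xs≤r)

∈⇒≤maxList : ∀ {x xs} → x ∈ xs → x ℚ.≤ maxList xs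
∈⇒≤maxList {xs = x ∷ xs} (here refl)   = ℚ.p≤p⊔q x (maxList xs)
∈⇒≤maxList {xs = y ∷ xs} (there x∈xs) = ℚ.≤-trans (∈⇒≤maxList x∈xs) (ℚ.p≤q⊔p y (maxList xs))

maxList-∈ : ∀ {x xs} → All (0ℚ ℚ.≤_) (x ∷ xs) → maxList (x ∷ xs) ∈ x ∷ xs
maxList-∈ (0≤x ∷ []) = here (ℚ.p≥q⇒p⊔q≡p 0≤x)
maxList-∈ {x} {y ∷ ys} (_ ∷ 0≤ys) with ℚ.⊔-sel x (maxList (y ∷ ys))
... | inj₁ max≡x    = here max≡x
... | inj₂ max≡rest = there (subst (_∈ y ∷ ys) (sym max≡rest) (maxList-∈ 0≤ys))

supNorm≡maxList : ∀ E f → supNorm E f ≡ maxList (map (λ z → ∣ f z ∣) E)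
supNorm≡maxList E f = sym (List.foldr-map _⊔_ (λ z → ∣ f z ∣) 0ℚ E)

∈⇒≤supNorm : ∀ {x E} f → x ∈ E → ∣ f x ∣ ℚ.≤ supNorm E f
∈⇒≤supNorm {x} {E} f x∈E =
  subst (∣ f x ∣ ℚ.≤_) (sym (supNorm≡maxList E f)) (∈⇒≤maxList (∈-map⁺ (λ z → ∣ f z ∣) x∈E))

supNorm-lub : ∀ {E} f → 0ℚ ℚ.≤ r → All (λ x → ∣ f x ∣ ℚ.≤ r) E → supNorm E f ℚ.≤ r
supNorm-lub {r} {E} f 0≤r bounded =
  subst (ℚ._≤ r) (sym (supNorm≡maxList E f)) (maxList-lub 0≤r (All.map⁺ bounded))

monic-supNorm-upper : ∀ E → 0ℚ < ε → ∃ λ N → ∀ {n} → N ≤ n →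
                      Σ (Monic n) λ P → supNorm E (evalMonic P) ℚ.≤ (maxList (map 1/↧ E) + ε) ^ℚ n
monic-supNorm-upper {ε} E 0<ε = length E ℕ.+ residueBound E ℕ.* ↧ₙ ε , λ {n} N≤n →
  let P , bounded = scaledValues-bounded E (ℕ.m+n≤o⇒m≤o (length E) N≤n)
      K = residueBound E
      L = maxList (map 1/↧ E)
      0≤L = 0≤maxList (map 1/↧ E)
      0≤ε = ℚ.<⇒≤ 0<ε
      L≤1 = maxList-lub (ℚ.nonNegative⁻¹ 1ℚ) (All.map⁺ (All.universal 1/↧≤1 E))
      K≤1+nε : ι (+ K) ℚ.≤ 1ℚ + ι (+ n) * ε
      K≤1+nε = ℚ.≤-trans (archimedean 0<ε K (ℕ.m+n≤o⇒n≤o (length E) N≤n))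
                         (p≤q+p (ℚ.nonNegative⁻¹ 1ℚ))
      pointwise : ∀ {x} → x ∈ E → ∣ evalMonic P x ∣ ℚ.≤ (L + ε) ^ℚ n
      pointwise {x} x∈E = begin
        ∣ evalMonic P x ∣            ≤⟨ ∣evalMonic∣≤1/↧^n*K P x (All.lookup bounded x∈E) ⟩
        1/↧ x ^ℚ n * ι (+ K)
          ≤⟨ *-monoʳ-≤-0≤ (0≤ι K) (^ℚ-monoˡ-≤ n (0≤1/↧ x) (∈⇒≤maxList (∈-map⁺ 1/↧ x∈E))) ⟩
        L ^ℚ n * ι (+ K)             ≤⟨ *-monoˡ-≤-0≤ (0≤^ℚ n 0≤L) K≤1+nε ⟩
        L ^ℚ n * (1ℚ + ι (+ n) * ε)  ≤⟨ ^ℚ-bernoulli n 0≤L L≤1 0≤ε ⟩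
        (L + ε) ^ℚ n                 ∎
  in P , supNorm-lub (evalMonic P) (0≤^ℚ n (ℚ.≤-trans 0≤L (p≤p+q 0≤ε))) (All.tabulate pointwise)
  where open ℚ.≤-Reasoning

monic-supNorm-lower : ∀ x xs → All (λ y → 2 ≤ ↧ₙ y) (x ∷ xs) → (P : Monic n) →
                      maxList (map 1/↧ (x ∷ xs)) ^ℚ n ℚ.≤ supNorm (x ∷ xs) (evalMonic P)
monic-supNorm-lower {n} x xs 2≤↧ P
  with ∈-map⁻ 1/↧ (maxList-∈ (All.map⁺ (All.universal 0≤1/↧ (x ∷ xs))))
... | y , y∈E , max≡1/↧y = begin
  maxList (map 1/↧ (x ∷ xs)) ^ℚ n  ≡⟨ cong (_^ℚ n) max≡1/↧y ⟩
  1/↧ y ^ℚ n                       ≤⟨ 1/↧^n≤∣evalMonic∣ P y (All.lookup 2≤↧ y∈E) ⟩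
  ∣ evalMonic P y ∣                ≤⟨ ∈⇒≤supNorm (evalMonic P) y∈E ⟩
  supNorm (x ∷ xs) (evalMonic P)   ∎
  where open ℚ.≤-Reasoning

0⊔[p-q]≤p : 0ℚ ℚ.≤ p → 0ℚ ℚ.≤ q → 0ℚ ⊔ (p - q) ℚ.≤ p
0⊔[p-q]≤p {p} 0≤p 0≤q =
  ℚ.⊔-lub 0≤p (ℚ.≤-trans (ℚ.+-monoʳ-≤ p (ℚ.neg-antimono-≤ 0≤q)) (ℚ.≤-reflexive (ℚ.+-identityʳ p)))

monicIntegerChebyshevBounds :
  ∀ x xs → All (λ y → 2 ≤ ↧ₙ y) (x ∷ xs) → ∀ {L} → L ≡ maxList (map 1/↧ (x ∷ xs)) →
  (ε : ℚ) → 0ℚ < ε →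
  Σ ℕ λ N → (n : ℕ) → N ≤ n →
    (Σ (Monic n) λ P → supNorm (x ∷ xs) (evalMonic P) ℚ.≤ (L + ε) ^ℚ n)
    × ((P : Monic n) → (0ℚ ⊔ (L - ε)) ^ℚ n ℚ.≤ supNorm (x ∷ xs) (evalMonic P))
monicIntegerChebyshevBounds x xs 2≤↧ {L} refl ε 0<ε =
  let N , upper = monic-supNorm-upper (x ∷ xs) 0<ε in
  N , λ n N≤n → upper N≤n , λ P →
    ℚ.≤-trans (^ℚ-monoˡ-≤ n (ℚ.p≤p⊔q 0ℚ (L - ε)) (0⊔[p-q]≤p (0≤maxList (map 1/↧ (x ∷ xs))) 0≤ε))
              (monic-supNorm-lower x xs 2≤↧ P)
  where
  0≤ε = ℚ.<⇒≤ 0<ε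

↧ₙ-frac : ∀ a b (h : 2 ≤ b) → Coprime ℤ.∣ a ∣ b → ↧ₙ (frac a b h) ≡ b
↧ₙ-frac a (suc c) _ coprime = cong ↧ₙ_ (ℚ.↥p/↧p≡p (mkℚ a c coprime))

frac-1≡1/↧ : ∀ {b} (h : 2 ≤ b) x → ↧ₙ x ≡ b → frac (+ 1) b h ≡ 1/↧ x
frac-1≡1/↧ h x refl = refl

tabulate-frac-1 : ∀ {k} (a : Fin k → ℤ) (b : Fin k → ℕ) (b≥2 : ∀ i → 2 ≤ b i) →
                  (∀ i → Coprime ℤ.∣ a i ∣ (b i)) →
                  tab (λ i → frac (+ 1) (b i) (b≥2 i)) ≡ map 1/↧ (tab (λ i → frac (a i) (b i) (b≥2 i)))
tabulate-frac-1 a b b≥2 coprime = trans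
  (List.tabulate-cong λ i →
    frac-1≡1/↧ (b≥2 i) (frac (a i) (b i) (b≥2 i)) (↧ₙ-frac (a i) (b i) (b≥2 i) (coprime i)))
  (sym (List.map-tabulate (λ i → frac (a i) (b i) (b≥2 i)) 1/↧))

corollary2p1 :
  (k : ℕ) (a : Fin (suc k) → ℤ) (b : Fin (suc k) → ℕ)
  (b≥2 : ∀ i → 2 ≤ b i) → (∀ i → Coprime ℤ.∣ a i ∣ (b i)) →
  let E : List ℚ
      E = tab (λ i → frac (a i) (b i) (b≥2 i))
      L : ℚ
      L = maxList (tab (λ i → frac (+ 1) (b i) (b≥2 i)))
  in (ε : ℚ) → 0ℚ < ε →
     Σ ℕ λ N → (n : ℕ) → N ≤ n →
       (Σ (Monic n) λ P → supNorm E (evalMonic P) ℚ.≤ ((L + ε) ^ℚ n))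
       × ((P : Monic n) → ((0ℚ ⊔ (L - ε)) ^ℚ n) ℚ.≤ supNorm E (evalMonic P))
corollary2p1 k a b b≥2 coprime =
  monicIntegerChebyshevBounds (x zero) (tab (x ∘ suc)) (All.tabulate⁺ {f = x} 2≤↧x)
                              (cong maxList (tabulate-frac-1 a b b≥2 coprime))
  where
  x : Fin (suc k) → ℚ
  x i = frac (a i) (b i) (b≥2 i)
  2≤↧x : ∀ i → 2 ≤ ↧ₙ x i
  2≤↧x i = subst (2 ≤_) (sym (↧ₙ-frac (a i) (b i) (b≥2 i) (coprime i))) (b≥2 i)
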